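{- Assume (G), (ND) and (QL) (see context), and fix periods and defects $P_\star,Q_\star$ for $\star\in\{d,\,d+d^{\mathrm{new}},\,d_p\}$. Then for every integer $i$: (a) $\mathrm{HZ}(\Delta^+_{i+Q_d})=\mathrm{HZ}(\Delta^+_i)+P_d$; (b) $\mathrm{LZ}(\Delta^+_{i+Q_{d_p}})=\mathrm{LZ}(\Delta^+_i)+2P_{d_p}$; (c) $\mathrm{HZ}(\Delta^-_{i+Q_{d_p}})=\mathrm{HZ}(\Delta^-_i)+2P_{d_p}$; (d) $\mathrm{LZ}(\Delta^-_{i+Q_{d+d^{\mathrm{new}}}})=\mathrm{LZ}(\Delta^-_i)+P_{d+d^{\mathrm{new}}}$.
   Context: Let $d,d^{\mathrm{new}}:\mathbb Z\to\mathbb Z$ be functions and $d_p=2d+d^{\mathrm{new}}$. A function $f:\mathbb Z\to\mathbb Z$ is quasi-linear if there are positive integers $P_f$ (period) and $Q_f$ (defect) with $f(n+P_f)=f(n)+Q_f$ for all $n$. Assume: (G) $d(n)\to\infty$ as $n\to+\infty$ and $d(n)+d^{\mathrm{new}}(n)\to-\infty$ as $n\to-\infty$; (ND) $d$, $d+d^{\mathrm{new}}$ and $d_p$ are non-decreasing; (QL) $d$ and $d^{\mathrm{new}}$ are quasi-linear (hence so are $d+d^{\mathrm{new}}$ and $d_p$). For an integer $i$ define $\mathrm{HZ}(\Delta_i^+)=\sup\{n\in\mathbb Z: d(n)<i\}$, $\mathrm{LZ}(\Delta_i^+)=\inf\{n\in\mathbb Z: i\le d(n)+\tfrac12d^{\mathrm{new}}(n)\}$,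 $\mathrm{HZ}(\Delta_i^-)=\sup\{n\in\mathbb Z: d(n)+\tfrac12d^{\mathrm{new}}(n)+1\le i\}$, $\mathrm{LZ}(\Delta_i^-)=\inf\{n\in\mathbb Z: i<d(n)+d^{\mathrm{new}}(n)\}$ (these are finite by (G) and (ND)). -}

module Defs where

open import Data.Integer using (ℤ; _+_; _*_; _≤_; _<_; +_)
open import Data.Product using (Σ; _×_; ∃)
open import Relation.Binary.PropositionalEquality using (_≡_)

_⊕_ : (ℤ → ℤ) → (ℤ → ℤ) → (ℤ → ℤ)
(f ⊕ g) n = f n + g n

dp : (ℤ → ℤ) → (ℤ → ℤ) → (ℤ → ℤ)
dp d dnew n = + 2 * d n + dnew n

NonDecreasing : (ℤ → ℤ) → Set
NonDecreasing f = ∀ m n → m ≤ n → f m ≤ f n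

TendsToPlusInfty : (ℤ → ℤ) → Set
TendsToPlusInfty f = ∀ (M : ℤ) → ∃ λ N → ∀ n → N ≤ n → M ≤ f n

TendsToMinusInftyAtMinusInfty : (ℤ → ℤ) → Set
TendsToMinusInftyAtMinusInfty f = ∀ (M : ℤ) → ∃ λ N → ∀ n → n ≤ N → f n ≤ M

IsPeriodDefect : (ℤ → ℤ) → ℤ → ℤ → Set
IsPeriodDefect f P Q = (+ 0 < P) × (+ 0 < Q) × (∀ n → f (n + P) ≡ f n + Q)

QuasiLinear : (ℤ → ℤ) → Set
QuasiLinear f = Σ ℤ λ P → Σ ℤ λ Q → IsPeriodDefect f P Q

IsSup : (ℤ → Set) → ℤ → Set
IsSup S m = S m × (∀ n → S n → n ≤ m)

IsInf : (ℤ → Set) → ℤ → Set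
IsInf S m = S m × (∀ n → S n → m ≤ n)

-- The four sets. Conditions with ½ d^new are multiplied by 2:
--   i ≤ d + ½ dnew        ⇔  2i ≤ 2d + dnew
--   d + ½ dnew + 1 ≤ i    ⇔  2d + dnew + 2 ≤ 2i
HZ⁺-set : (d dnew : ℤ → ℤ) → ℤ → ℤ → Set
HZ⁺-set d dnew i n = d n < i

LZ⁺-set : (d dnew : ℤ → ℤ) → ℤ → ℤ → Set
LZ⁺-set d dnew i n = + 2 * i ≤ + 2 * d n + dnew n

HZ⁻-set : (d dnew : ℤ → ℤ) → ℤ → ℤ → Set
HZ⁻-set d dnew i n = + 2 * d n + dnew n + + 2 ≤ + 2 * i

LZ⁻-set : (d dnew : ℤ → ℤ) → ℤ → ℤ → Set
LZ⁻-set d dnew i n = i < d n + dnew n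

IsHZ⁺ IsLZ⁺ IsHZ⁻ IsLZ⁻ : (d dnew : ℤ → ℤ) → ℤ → ℤ → Set
IsHZ⁺ d dnew i = IsSup (HZ⁺-set d dnew i)
IsLZ⁺ d dnew i = IsInf (LZ⁺-set d dnew i)
IsHZ⁻ d dnew i = IsSup (HZ⁻-set d dnew i)
IsLZ⁻ d dnew i = IsInf (LZ⁻-set d dnew i)

module Submission where

-- Lemma 4.7 is a translation argument.  If f(n + P) = f(n) + Q, then for
-- any relation R on ℤ invariant under translating both sides,
--     R (f n) c  ⇔  R (f (n + P)) (c + Q),
-- so n ↦ n + P maps the level set {n : R (f n) c} bijectively onto
-- {n : R (f n) (c + Q)}; translating a set moves its supremum/infimum by
-- the same amount.  Each of the four zero positions is the sup or inf of
-- such a level set: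
--   (a) d n < i                 with period/defect (P_d, Q_d);
--   (b) 2i ≤ d_p n              with (2P_{d_p}, 2Q_{d_p});
--   (c) d_p n + 2 ≤ 2i          with (2P_{d_p}, 2Q_{d_p});
--   (d) i < (d + d^new) n       with (P_{d+d^new}, Q_{d+d^new}).  Hypotheses (G), (ND), (QL) only guarantee
-- that the extrema exist; given them, the shift needs only periodicity.

open import Defs
open import Data.Nat using (ℕ; zero; suc)
open import Data.Integer using (ℤ; _+_; _*_; +_; -_; _-_; _≤_; _<_)
open import Data.Integer.Properties
  using (+-assoc; +-comm; +-identityʳ; *-identityˡ; *-distribˡ-+; *-distribʳ-+;
         +-monoˡ-≤; +-monoˡ-<; +-0-abelianGroup)
open import Algebra.Bundles using (AbelianGroup)
open import Algebra.Properties.Group (AbelianGroup.group +-0-abelianGroup)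
  using (//-rightDividesˡ; //-rightDividesʳ)
open import Data.Product using (_×_; _,_)
open import Function using (flip)
open import Function.Bundles using (_⇔_; mk⇔; Equivalence)
open import Relation.Binary.PropositionalEquality
  using (_≡_; refl; sym; trans; cong; subst; subst₂; module ≡-Reasoning)

Periodic : (ℤ → ℤ) → ℤ → ℤ → Set
Periodic f P Q = ∀ n → f (n + P) ≡ f n + Q

shift-back : ∀ n P → n - P + P ≡ n
shift-back n P = //-rightDividesˡ P n

unshift : ∀ n P → n + P - P ≡ n
unshift n P = //-rightDividesʳ P n

periodic-multiple : ∀ f {P Q} → Periodic f P Q →
                    ∀ k → Periodic f (+ k * P) (+ k * Q)
periodic-multiple f {P} {Q} per zero n = begin
  f (n + + 0)   ≡⟨ cong f (+-identityʳ n) ⟩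
  f n           ≡⟨ sym (+-identityʳ (f n)) ⟩
  f n + + 0     ∎
  where open ≡-Reasoning
periodic-multiple f {P} {Q} per (suc k) n = begin
  f (n + + suc k * P)       ≡⟨ cong (λ x → f (n + x)) (one-more P) ⟩
  f (n + (P + + k * P))     ≡⟨ cong f (sym (+-assoc n P (+ k * P))) ⟩
  f (n + P + + k * P)       ≡⟨ periodic-multiple f per k (n + P) ⟩
  f (n + P) + + k * Q       ≡⟨ cong (_+ + k * Q) (per n) ⟩
  f n + Q + + k * Q         ≡⟨ +-assoc (f n) Q (+ k * Q) ⟩
  f n + (Q + + k * Q)       ≡⟨ cong (λ x → f n + x) (sym (one-more Q)) ⟩
  f n + + suc k * Q         ∎
  where
  open ≡-Reasoning
  one-more : ∀ x → + suc k * x ≡ x + + k * x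
  one-more x = trans (*-distribʳ-+ x (+ 1) (+ k)) (cong (_+ + k * x) (*-identityˡ x))

periodic-offset : ∀ f {P Q} → Periodic f P Q → ∀ c → Periodic (λ n → f n + c) P Q
periodic-offset f {P} {Q} per c n = begin
  f (n + P) + c     ≡⟨ cong (_+ c) (per n) ⟩
  f n + Q + c       ≡⟨ +-assoc (f n) Q c ⟩
  f n + (Q + c)     ≡⟨ cong (λ x → f n + x) (+-comm Q c) ⟩
  f n + (c + Q)     ≡⟨ sym (+-assoc (f n) c Q) ⟩
  f n + c + Q       ∎
  where open ≡-Reasoning

TranslationInvariant : (ℤ → ℤ → Set) → Set
TranslationInvariant R = ∀ k {a b} → R a b → R (a + k) (b + k)

<-invariant : TranslationInvariant _<_
<-invariant = +-monoˡ-<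

≤-invariant : TranslationInvariant _≤_
≤-invariant = +-monoˡ-≤

flip-invariant : ∀ {R} → TranslationInvariant R → TranslationInvariant (flip R)
flip-invariant inv k = inv k

invariant⇔ : ∀ {R} → TranslationInvariant R → ∀ k {a b} → R a b ⇔ R (a + k) (b + k)
invariant⇔ {R} inv k {a} {b} = mk⇔ (inv k) λ r →
  subst₂ R (unshift a k) (unshift b k) (inv (- k) r)

level-shift : ∀ {R} f {P Q c c'} → TranslationInvariant R → Periodic f P Q →
              c + Q ≡ c' → ∀ n → R (f n) c ⇔ R (f (n + P)) c'
level-shift {R} f {P} {Q} {c} inv per c+Q≡c' n =
  subst (λ x → R (f n) c ⇔ R x _) (sym (per n))
    (subst (λ y → R (f n) c ⇔ R (f n + Q) y) c+Q≡c' (invariant⇔ inv Q))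

Translate : (ℤ → Set) → (ℤ → Set) → ℤ → Set
Translate S T P = ∀ n → S n ⇔ T (n + P)

translate-preimage : ∀ {S T P} → Translate S T P → ∀ n → T n → S (n - P)
translate-preimage {T = T} {P} tr n t =
  Equivalence.from (tr (n - P)) (subst T (sym (shift-back n P)) t)

sup-translate : ∀ {S T P m} → Translate S T P → IsSup S m → IsSup T (m + P)
sup-translate {P = P} {m} tr (sm , upper) =
  Equivalence.to (tr m) sm ,
  λ n t → subst (_≤ m + P) (shift-back n P)
            (+-monoˡ-≤ P (upper (n - P) (translate-preimage tr n t)))

inf-translate : ∀ {S T P m} → Translate S T P → IsInf S m → IsInf T (m + P)
inf-translate {P = P} {m} tr (sm , lower) =
  Equivalence.to (tr m) sm ,
  λ n t → subst (m + P ≤_) (shift-back n P)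
            (+-monoˡ-≤ P (lower (n - P) (translate-preimage tr n t)))

lemma4p7 : (d dnew : ℤ → ℤ)
    → TendsToPlusInfty d
    → TendsToMinusInftyAtMinusInfty (d ⊕ dnew)
    → NonDecreasing d → NonDecreasing (d ⊕ dnew) → NonDecreasing (dp d dnew)
    → QuasiLinear d → QuasiLinear dnew
    → (Pd Qd Pdn Qdn Pp Qp : ℤ)
    → IsPeriodDefect d Pd Qd
    → IsPeriodDefect (d ⊕ dnew) Pdn Qdn
    → IsPeriodDefect (dp d dnew) Pp Qp
    → (i : ℤ)
    → (∀ m → IsHZ⁺ d dnew i m → IsHZ⁺ d dnew (i + Qd) (m + Pd))
    × (∀ m → IsLZ⁺ d dnew i m → IsLZ⁺ d dnew (i + Qp) (m + + 2 * Pp))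
    × (∀ m → IsHZ⁻ d dnew i m → IsHZ⁻ d dnew (i + Qp) (m + + 2 * Pp))
    × (∀ m → IsLZ⁻ d dnew i m → IsLZ⁻ d dnew (i + Qdn) (m + Pdn))
lemma4p7 d dnew _ _ _ _ _ _ _ Pd Qd Pdn Qdn Pp Qp
         (_ , _ , per-d) (_ , _ , per-dn) (_ , _ , per-p) i =
    (λ _ → sup-translate (level-shift d <-invariant per-d refl))
  , (λ _ → inf-translate (level-shift (dp d dnew) (flip-invariant ≤-invariant) per-2p double-level))
  , (λ _ → sup-translate (level-shift dp+2 ≤-invariant per-2p+2 double-level))
  , (λ _ → inf-translate (level-shift (d ⊕ dnew) (flip-invariant <-invariant) per-dn refl))
  where
  -- d_p has period 2P_{d_p} and defect 2Q_{d_p}; the doubled level 2i moves to 2(i + Q_{d_p}).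
  per-2p : Periodic (dp d dnew) (+ 2 * Pp) (+ 2 * Qp)
  per-2p = periodic-multiple (dp d dnew) per-p 2
  -- the set of (c) is the ≤-level set of d_p + 2, which has the same period and defect
  dp+2 : ℤ → ℤ
  dp+2 n = dp d dnew n + + 2
  per-2p+2 : Periodic dp+2 (+ 2 * Pp) (+ 2 * Qp)
  per-2p+2 = periodic-offset (dp d dnew) per-2p (+ 2)
  double-level : + 2 * i + + 2 * Qp ≡ + 2 * (i + Qp)
  double-level = sym (*-distribˡ-+ (+ 2) i Qp)
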